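{- Let $G$ be an induced-minor-minimal non-$2$-cograph. Then both $G$ and $\overline{G}$ are $2$-connected.
   Context: All graphs are finite and simple; $\overline{G}$ denotes the complement of $G$. A graph is $2$-connected if it has at least three vertices, is connected, and has no cut vertex. A graph $G$ is a $2$-cograph if $G$ has no induced subgraph $H$ such that both $H$ and $\overline{H}$ are $2$-connected. For an edge $e$, $G/e$ is the simple graph obtained by contracting $e$ and removing parallel edges. An induced minor of $G$ is a graph obtained from $G$ by a sequence of vertex deletions and edge contractions; it is proper if at least one such operation is performed. An induced-minor-minimal non-$2$-cograph is a graph that is not a $2$-cograph but all of whose proper induced minors are $2$-cographs. -}

module Defs where

open import Data.Nat using (ℕ; zero; suc; _≤_)
open import Data.Fin using (Fin; punchIn; punchOut)
open import Data.Fin.Properties using (_≟_)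
open import Data.Bool using (Bool; true; false; not; _∧_; _∨_)
open import Data.Bool.Properties using (∨-comm; ∨-assoc)
open import Data.Product using (Σ; _×_; ∃)
open import Data.Empty using (⊥)
open import Relation.Nullary using (¬_; does)
open import Relation.Binary.PropositionalEquality
open import Function.Definitions using (Injective)

record Graph (n : ℕ) : Set where
  field
    adj    : Fin n → Fin n → Bool
    adj-sym : ∀ i j → adj i j ≡ adj j i
    irrefl : ∀ i → adj i i ≡ false
open Graph public

_==_ : ∀ {n} → Fin n → Fin n → Bool
i == j = does (i ≟ j)

==-sym : ∀ {n} (i j : Fin n) → (i == j) ≡ (j == i)
==-sym i j with i ≟ j | j ≟ i
... | Relation.Nullary.yes _ | Relation.Nullary.yes _ = refl
... | Relation.Nullary.no _  | Relation.Nullary.no _  = refl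
... | Relation.Nullary.yes p | Relation.Nullary.no q  = ⊥-elim' (q (sym p))
  where ⊥-elim' : ∀ {A : Set} → ⊥ → A
        ⊥-elim' ()
... | Relation.Nullary.no q  | Relation.Nullary.yes p = ⊥-elim' (q (sym p))
  where ⊥-elim' : ∀ {A : Set} → ⊥ → A
        ⊥-elim' ()

==-refl : ∀ {n} (i : Fin n) → (i == i) ≡ true
==-refl i with i ≟ i
... | Relation.Nullary.yes _ = refl
... | Relation.Nullary.no q  = ⊥-elim' (q refl)
  where ⊥-elim' : ∀ {A : Set} → ⊥ → A
        ⊥-elim' ()

complement : ∀ {n} → Graph n → Graph n
complement G = record
  { adj    = λ i j → not (i == j) ∧ not (adj G i j)
  ; adj-sym = λ i j → cong₂ (λ a b → not a ∧ not b) (==-sym i j) (Graph.adj-sym G i j)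
  ; irrefl = λ i → cong (λ a → not a ∧ not (adj G i i)) (==-refl i)
  }

-- The subgraph induced by the image of f (an induced subgraph when f is injective).
induced : ∀ {n m} → Graph n → (Fin m → Fin n) → Graph m
induced G f = record
  { adj    = λ i j → adj G (f i) (f j)
  ; adj-sym = λ i j → Graph.adj-sym G (f i) (f j)
  ; irrefl = λ i → irrefl G (f i)
  }

delete : ∀ {n} → Graph (suc n) → Fin (suc n) → Graph n
delete G v = induced G (punchIn v)

-- Edge contraction G / uv (v is merged into u; loops and parallel edges removed).
private
  adj≢ : ∀ {n} (G : Graph n) {u v} → adj G u v ≡ true → ¬ (v ≡ u)
  adj≢ G {u} e refl with trans (sym e) (irrefl G u)
  ... | ()

  swap-or : ∀ a b c → a ∨ b ∨ c ≡ a ∨ c ∨ b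
  swap-or a b c = cong (a ∨_) (∨-comm b c)

contract : ∀ {n} (G : Graph (suc n)) (u v : Fin (suc n)) → adj G u v ≡ true → Graph n
contract {n} G u v e = record
  { adj    = A
  ; adj-sym = symA
  ; irrefl = λ i → cong (λ a → not a ∧ B i i) (==-refl i)
  }
  where
    p : Fin n → Fin (suc n)
    p = punchIn v
    u' : Fin n
    u' = punchOut (adj≢ G e)
    B : Fin n → Fin n → Bool
    B i j = adj G (p i) (p j) ∨ ((i == u') ∧ adj G v (p j)) ∨ ((j == u') ∧ adj G v (p i))
    A : Fin n → Fin n → Bool
    A i j = not (i == j) ∧ B i j
    symB : ∀ i j → B i j ≡ B j i
    symB i j rewrite Graph.adj-sym G (p i) (p j) =
      swap-or (adj G (p j) (p i)) ((i == u') ∧ adj G v (p j)) ((j == u') ∧ adj G v (p i))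
    symA : ∀ i j → A i j ≡ A j i
    symA i j = cong₂ (λ a b → not a ∧ b) (==-sym i j) (symB i j)

data Walk {n} (G : Graph n) : Fin n → Fin n → Set where
  here : ∀ {u} → Walk G u u
  step : ∀ {u w v} → adj G u w ≡ true → Walk G w v → Walk G u v

Connected : ∀ {n} → Graph n → Set
Connected G = ∀ u v → Walk G u v

TwoConnected : ∀ {n} → Graph n → Set
TwoConnected {zero}  G = ⊥
TwoConnected {suc n} G = 3 ≤ suc n × Connected G × (∀ v → Connected (delete G v))

Is2Cograph : ∀ {n} → Graph n → Set
Is2Cograph {n} G =
  ¬ (Σ ℕ λ m → Σ (Fin m → Fin n) λ f → Injective _≡_ _≡_ f ×
       TwoConnected (induced G f) × TwoConnected (complement (induced G f)))

data Step : ∀ {n m} → Graph n → Graph m → Set where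
  del : ∀ {n} (G : Graph (suc n)) (v : Fin (suc n)) → Step G (delete G v)
  con : ∀ {n} (G : Graph (suc n)) (u v : Fin (suc n)) (e : adj G u v ≡ true) →
        Step G (contract G u v e)

data InducedMinor : ∀ {n m} → Graph n → Graph m → Set where
  done : ∀ {n} {G : Graph n} → InducedMinor G G
  _∷_  : ∀ {n k m} {G : Graph n} {K : Graph k} {H : Graph m} →
         Step G K → InducedMinor K H → InducedMinor G H

ProperInducedMinor : ∀ {n m} → Graph n → Graph m → Set
ProperInducedMinor {n} {m} G H = Σ ℕ λ k → Σ (Graph k) λ K → Step G K × InducedMinor K H

MinimalNon2Cograph : ∀ {n} → Graph n → Set
MinimalNon2Cograph G =
  ¬ Is2Cograph G × (∀ {m} (H : Graph m) → ProperInducedMinor G H → Is2Cograph H)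

-- G is not a 2-cograph, so some induced subgraph G[S] has G[S] and its complement 2-connected.
-- If S missed a vertex v, then G[S] would already be an induced subgraph of the proper induced
-- minor G - v, which is a 2-cograph by minimality; hence S is everything and G[S] is G itself.
-- Constructively the witness sits under a double negation, which is harmless because
-- 2-connectivity of a finite graph is decidable.
module Submission where

open import Defs
open import Data.Nat using (ℕ; zero; suc)
open import Data.Nat.Properties using (≤-trans) renaming (_≤?_ to _≤ℕ?_)
open import Data.Product using (_×_; _,_; Σ; ∃; proj₁)
open import Data.Fin using (Fin; punchIn; punchOut)
open import Data.Fin.Properties
  using (_≟_; punchIn-punchOut; punchInᵢ≢i; punchIn-injective; injective⇒≤; any?; all?)
open import Data.Bool using (true; not; _∧_)
import Data.Bool as Bool
open import Data.Empty using (⊥; ⊥-elim)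
open import Relation.Nullary using (¬_; Dec; yes; no)
open import Relation.Nullary.Decidable using (_×-dec_; decidable-stable)
open import Relation.Binary.PropositionalEquality
open import Function.Definitions using (Injective)

Homomorphism : ∀ {m n} → Graph m → Graph n → (Fin m → Fin n) → Set
Homomorphism K H f = ∀ x y → adj K x y ≡ true → adj H (f x) (f y) ≡ true

Onto : ∀ {m n} → (Fin m → Fin n) → Set
Onto {m} f = ∀ y → Σ (Fin m) λ x → f x ≡ y

BothTwoConnected : ∀ {n} → Graph n → Set
BothTwoConnected H = TwoConnected H × TwoConnected (complement H)

Walk-map : ∀ {m n} {K : Graph m} {H : Graph n} {f : Fin m → Fin n} →
  Homomorphism K H f → ∀ {a b} → Walk K a b → Walk H (f a) (f b)
Walk-map hom here       = here
Walk-map hom (step e w) = step (hom _ _ e) (Walk-map hom w)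

Connected-onto-hom : ∀ {m n} {K : Graph m} {H : Graph n} {f : Fin m → Fin n} →
  Onto f → Homomorphism K H f → Connected K → Connected H
Connected-onto-hom onto hom c u v with onto u | onto v
... | a , refl | b , refl = Walk-map hom (c a b)

delete-bij-hom : ∀ {m n} {K : Graph (suc m)} {H : Graph (suc n)} {f : Fin (suc m) → Fin (suc n)} →
  Injective _≡_ _≡_ f → Onto f → Homomorphism K H f →
  ∀ w → ∃ λ (g : Fin m → Fin n) → Onto g × Homomorphism (delete K w) (delete H (f w)) g
delete-bij-hom {m} {n} {K} {H} {f} inj onto hom w = g , g-onto , g-hom
  where
    fw≢f∘punchIn : ∀ x → f w ≢ f (punchIn w x)
    fw≢f∘punchIn x eq = punchInᵢ≢i w x (inj (sym eq))

    g : Fin m → Fin n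
    g x = punchOut (fw≢f∘punchIn x)

    punchIn∘g : ∀ x → punchIn (f w) (g x) ≡ f (punchIn w x)
    punchIn∘g x = punchIn-punchOut (fw≢f∘punchIn x)

    g-hom : Homomorphism (delete K w) (delete H (f w)) g
    g-hom x y e = trans (cong₂ (adj H) (punchIn∘g x) (punchIn∘g y)) (hom _ _ e)

    g-onto : Onto g
    g-onto a with onto (punchIn (f w) a)
    ... | z , fz≡ = punchOut w≢z , punchIn-injective (f w) _ a (begin
        punchIn (f w) (g (punchOut w≢z)) ≡⟨ punchIn∘g _ ⟩
        f (punchIn w (punchOut w≢z))     ≡⟨ cong f (punchIn-punchOut w≢z) ⟩
        f z                              ≡⟨ fz≡ ⟩
        punchIn (f w) a                  ∎)
      where
        open ≡-Reasoning
        w≢z : w ≢ z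
        w≢z refl = punchInᵢ≢i (f w) a (sym fz≡)

TwoConnected-bij-hom : ∀ {m n} {K : Graph m} {H : Graph n} {f : Fin m → Fin n} →
  Injective _≡_ _≡_ f → Onto f → Homomorphism K H f → TwoConnected K → TwoConnected H
TwoConnected-bij-hom {zero} _ _ _ ()
TwoConnected-bij-hom {suc m} {zero} inj _ _ _ with injective⇒≤ inj
... | ()
TwoConnected-bij-hom {suc m} {suc n} {K} {H} inj onto hom (three≤ , conn , conn-del) =
  ≤-trans three≤ (injective⇒≤ inj) , Connected-onto-hom {K = K} {H} onto hom conn , conn-del′
  where
    conn-del′ : ∀ v → Connected (delete H v)
    conn-del′ v with onto v
    ... | w , refl with delete-bij-hom {K = K} {H} inj onto hom w
    ...   | g , g-onto , g-hom = Connected-onto-hom {K = delete K w} g-onto g-hom (conn-del w)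

TwoConnected-cong : ∀ {n} {K H : Graph n} →
  (∀ x y → adj K x y ≡ adj H x y) → TwoConnected K → TwoConnected H
TwoConnected-cong eq =
  TwoConnected-bij-hom (λ e → e) (λ y → y , refl) (λ x y e → trans (sym (eq x y)) e)

BothTwoConnected-cong : ∀ {n} {K H : Graph n} →
  (∀ x y → adj K x y ≡ adj H x y) → BothTwoConnected K → BothTwoConnected H
BothTwoConnected-cong eq (tc , tc̅) =
  TwoConnected-cong eq tc ,
  TwoConnected-cong (λ x y → cong (λ b → not (x == y) ∧ not b) (eq x y)) tc̅

==-injective : ∀ {m n} {f : Fin m → Fin n} → Injective _≡_ _≡_ f → ∀ x y → (f x == f y) ≡ (x == y)
==-injective {f = f} inj x y with x ≟ y | f x ≟ f y
... | yes _    | yes _ = refl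
... | no _     | no _  = refl
... | yes refl | no q  = ⊥-elim (q refl)
... | no q     | yes p = ⊥-elim (q (inj p))

BothTwoConnected-spanning : ∀ {m n} (G : Graph n) {f : Fin m → Fin n} →
  Injective _≡_ _≡_ f → Onto f → BothTwoConnected (induced G f) → BothTwoConnected G
BothTwoConnected-spanning G inj onto (tc , tc̅) =
  TwoConnected-bij-hom inj onto (λ x y e → e) tc ,
  TwoConnected-bij-hom inj onto
    (λ x y e → trans (cong (λ b → not b ∧ not (adj G _ _)) (==-injective inj x y)) e) tc̅

induced-avoiding : ∀ {m n} (G : Graph (suc n)) (v : Fin (suc n)) {f : Fin m → Fin (suc n)} →
  Injective _≡_ _≡_ f → (∀ x → f x ≢ v) →
  ∃ λ (g : Fin m → Fin n) → Injective _≡_ _≡_ g × (∀ x y → adj (induced G f) x y ≡ adj (induced (delete G v) g) x y)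
induced-avoiding {m} {n} G v {f} inj avoids = g , g-inj , λ x y → sym (cong₂ (adj G) (punchIn∘g x) (punchIn∘g y))
  where
    v≢f : ∀ x → v ≢ f x
    v≢f x eq = avoids x (sym eq)

    g : Fin m → Fin n
    g x = punchOut (v≢f x)

    punchIn∘g : ∀ x → punchIn v (g x) ≡ f x
    punchIn∘g x = punchIn-punchOut (v≢f x)

    g-inj : Injective _≡_ _≡_ g
    g-inj {x} {y} e = inj (trans (sym (punchIn∘g x)) (trans (cong (punchIn v) e) (punchIn∘g y)))

-- A walk ending outside u either avoids u, or its last departure from u enters G - u at a neighbour.
data LastExit {n} (G : Graph (suc n)) (u x : Fin (suc n)) (v : Fin n) : Set where
  via-neighbour : ∀ w → adj G u (punchIn u w) ≡ true → Walk (delete G u) w v → LastExit G u x v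
  avoiding      : (u≢x : u ≢ x) → Walk (delete G u) (punchOut u≢x) v → LastExit G u x v

lastExit : ∀ {n} (G : Graph (suc n)) (u : Fin (suc n)) (v : Fin n) {x} →
  Walk G x (punchIn u v) → LastExit G u x v
lastExit G u v here = avoiding u≢v (subst (λ z → Walk (delete G u) z v) (sym punchOut∘punchIn) here)
  where
    u≢v : u ≢ punchIn u v
    u≢v eq = punchInᵢ≢i u v (sym eq)
    punchOut∘punchIn : punchOut u≢v ≡ v
    punchOut∘punchIn = punchIn-injective u _ _ (punchIn-punchOut u≢v)
lastExit G u v {x} (step e walk) with lastExit G u v walk
... | via-neighbour w a rest = via-neighbour w a rest
... | avoiding u≢y rest with u ≟ x
...   | yes refl = via-neighbour (punchOut u≢y) (trans (cong (adj G u) (punchIn-punchOut u≢y)) e) rest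
...   | no u≢x  = avoiding u≢x
                   (step (trans (cong₂ (adj G) (punchIn-punchOut u≢x) (punchIn-punchOut u≢y)) e) rest)

Walk? : ∀ {n} (G : Graph n) u v → Dec (Walk G u v)
Walk? {zero} G () v
Walk? {suc n} G u v with u ≟ v
... | yes refl = yes here
... | no u≢v with any? first-step?
  where
    first-step? : ∀ w → Dec (adj G u (punchIn u w) ≡ true × Walk (delete G u) w (punchOut u≢v))
    first-step? w = (adj G u (punchIn u w) Bool.≟ true) ×-dec Walk? (delete G u) w (punchOut u≢v)
...   | yes (w , e , rest) =
  yes (step e (subst (Walk G (punchIn u w)) (punchIn-punchOut u≢v) (Walk-map (λ _ _ e → e) rest)))
...   | no no-first-step =
  no λ walk → refute (lastExit G u (punchOut u≢v) (subst (Walk G u) (sym (punchIn-punchOut u≢v)) walk))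
  where
    refute : LastExit G u u (punchOut u≢v) → ⊥
    refute (via-neighbour w e rest) = no-first-step (w , e , rest)
    refute (avoiding u≢u _)         = u≢u refl

Connected? : ∀ {n} (G : Graph n) → Dec (Connected G)
Connected? G = all? λ u → all? λ v → Walk? G u v

TwoConnected? : ∀ {n} (G : Graph n) → Dec (TwoConnected G)
TwoConnected? {zero}  G = no λ ()
TwoConnected? {suc n} G = (3 ≤ℕ? suc n) ×-dec Connected? G ×-dec all? λ v → Connected? (delete G v)

witness-onto : ∀ {m n} (G : Graph n) → MinimalNon2Cograph G →
  {f : Fin m → Fin n} → Injective _≡_ _≡_ f → BothTwoConnected (induced G f) → Onto f
witness-onto {m} {suc n} G (_ , minimal) {f} inj both v with any? (λ x → f x ≟ v)
... | yes hit = hit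
... | no miss with induced-avoiding G v inj (λ x fx≡v → miss (x , fx≡v))
...   | g , g-inj , same-adj =
  ⊥-elim (minimal (delete G v) (n , delete G v , del G v , done)
                  (m , g , g-inj , BothTwoConnected-cong same-adj both))

minimal-BothTwoConnected : ∀ {n} (G : Graph n) → MinimalNon2Cograph G →
  ¬ ¬ BothTwoConnected G
minimal-BothTwoConnected G mn not-both =
  proj₁ mn λ (_ , _ , inj , both) →
    not-both (BothTwoConnected-spanning G inj (witness-onto G mn inj both) both)

lemma3p4 : ∀ {n : ℕ} (G : Graph n) → MinimalNon2Cograph G →
    TwoConnected G × TwoConnected (complement G)
lemma3p4 G mn =
  decidable-stable (TwoConnected? G ×-dec TwoConnected? (complement G))
                   (minimal-BothTwoConnected G mn)
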